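{- For $n \ge 1$ let \[\mathcal{A}_n = \Big\{ x \in [0,1]^n : \sum_{i\in I} x_i + \sum_{i\notin I}(1-x_i) \ge \tfrac12 \text{ for all } I \subseteq [n]\Big\}.\] Then $\mathcal{A}_n$ has a symmetric extension of size $O(n)$ with respect to the group $\mathbb{Z}_2 \wr S_n$ of symmetries of the cube $[0,1]^n$ (generated by coordinate permutations and the reflections $x_i \mapsto 1-x_i$).
   Context: For a finite group $G$ acting affinely on $\mathbb{R}^m$ and a $G$-invariant polytope $P\subseteq\mathbb{R}^m$, a symmetric extension is a polytope $Q\subseteq\mathbb{R}^d$ invariant under some affine $G$-action on $\mathbb{R}^d$, together with a linear map $p\colon\mathbb{R}^d\to\mathbb{R}^m$ with $p(Q)=P$ and $p(gx)=g\,p(x)$ for all $g\in G$, $x \in Q$. Its size is the number of facets of $Q$.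
   Formalization: Stated over ℚ rather than ℝ: $\mathcal{A}_n$ is replaced by its rational points, and Q, the linear map p and the affine action are taken over ℚ^d and ℚ^n. -}

module Defs where

open import Data.Nat using (ℕ; zero; suc)
open import Data.Fin using (Fin; zero; suc)
open import Data.Bool using (Bool; true; false; _xor_)
open import Data.Rational using (ℚ; 0ℚ; 1ℚ; ½; _+_; _*_; _-_; _≤_)
open import Data.Fin.Permutation using (Permutation′; _⟨$⟩ʳ_; _⟨$⟩ˡ_; _∘ₚ_)
open import Data.Fin.Subset using (Subset)
open import Data.Vec using (lookup)
import Data.Nat
import Data.Fin.Permutation
open import Data.Product using (Σ; _×_; _,_)
open import Relation.Binary.PropositionalEquality using (_≡_)

Pt : ℕ → Set
Pt d = Fin d → ℚ

∑ : ∀ {k} → (Fin k → ℚ) → ℚ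
∑ {zero}  f = 0ℚ
∑ {suc k} f = f zero + ∑ (λ i → f (suc i))

Mat : ℕ → ℕ → Set
Mat r c = Fin r → Fin c → ℚ

_·ᵥ_ : ∀ {r c} → Mat r c → Pt c → Pt r
(M ·ᵥ y) i = ∑ (λ j → M i j * y j)

termI : ∀ {n} → Subset n → Pt n → Fin n → ℚ
termI I x i with lookup I i
... | true  = x i
... | false = 1ℚ - x i

InA : (n : ℕ) → Pt n → Set
InA n x = ((i : Fin n) → (0ℚ ≤ x i) × (x i ≤ 1ℚ))
        × ((I : Subset n) → ½ ≤ ∑ (termI I x))

record Hyp (n : ℕ) : Set where
  constructor hyp
  field
    perm  : Permutation′ n
    flips : Fin n → Bool
open Hyp public

flipIf : Bool → ℚ → ℚ
flipIf true  v = 1ℚ - v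
flipIf false v = v

hact : ∀ {n} → Hyp n → Pt n → Pt n
hact g x i = flipIf (flips g i) (x (perm g ⟨$⟩ˡ i))

-- group law, chosen so that hact (g ⊗ h) = hact g ∘ hact h
_⊗_ : ∀ {n} → Hyp n → Hyp n → Hyp n
g ⊗ h = hyp (perm h ∘ₚ perm g) (λ i → flips g i xor flips h (perm g ⟨$⟩ˡ i))

record HPoly (d : ℕ) : Set where
  constructor hpoly
  field
    k e   : ℕ
    A     : Mat k d
    b     : Pt k
    E     : Mat e d
    f     : Pt e
open HPoly public

InQ : ∀ {d} → HPoly d → Pt d → Set
InQ Q y = ((r : Fin (k Q)) → (A Q ·ᵥ y) r ≤ b Q r)
        × ((r : Fin (e Q)) → (E Q ·ᵥ y) r ≡ f Q r)

Bounded : ∀ {d} → HPoly d → Set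
Bounded {d} Q = Σ ℚ λ M → (y : Pt d) → InQ Q y →
  (j : Fin d) → (0ℚ - M ≤ y j) × (y j ≤ M)

record AffAction (n d : ℕ) : Set where
  constructor affAction
  field
    lin   : Hyp n → Mat d d
    trans : Hyp n → Pt d
open AffAction public

aact : ∀ {n d} → AffAction n d → Hyp n → Pt d → Pt d
aact ρ g y j = (lin ρ g ·ᵥ y) j + trans ρ g j

IsAction : ∀ {n d} → AffAction n d → Set
IsAction {n} {d} ρ =
    ((y : Pt d) (j : Fin d) → aact ρ (hyp Data.Fin.Permutation.id (λ _ → false)) y j ≡ y j)
  × ((g h : Hyp n) (y : Pt d) (j : Fin d) →
       aact ρ (g ⊗ h) y j ≡ aact ρ g (aact ρ h y) j)

-- Size = number of facets of Q. A polytope with at most s facets is exactly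
-- one having a description with at most s inequalities (plus equations).
record SymExt (n s : ℕ) : Set where
  field
    d      : ℕ
    Q      : HPoly d
    size≤  : k Q Data.Nat.≤ s
    bdd    : Bounded Q
    ρ      : AffAction n d
    isAct  : IsAction ρ
    inv    : (g : Hyp n) (y : Pt d) → InQ Q y → InQ Q (aact ρ g y)
    p      : Mat n d
    proj⊆  : (y : Pt d) → InQ Q y → InA n (p ·ᵥ y)
    proj⊇  : (x : Pt n) → InA n x → Σ (Pt d) λ y → InQ Q y × ((i : Fin n) → (p ·ᵥ y) i ≡ x i)
    equiv  : (g : Hyp n) (y : Pt d) → InQ Q y →
             (i : Fin n) → (p ·ᵥ aact ρ g y) i ≡ hact g (p ·ᵥ y) i

module Submission where

open import Defs
open import Data.Nat using (ℕ; _≤_; _*_)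
open import Data.Product using (Σ; _×_)

-- The extension.  Write a point of ℚ^(n+n) as a pair (x , t) of points of ℚⁿ and let
--
--   Ext x t  :⇔  tᵢ ≤ xᵢ ,  tᵢ ≤ 1 - xᵢ ,  0 ≤ tᵢ  (for all i)   and   ½ ≤ ∑ᵢ tᵢ .
--
-- These are 3n + 1 linear inequalities.  The projection (x , t) ↦ x maps this polytope
-- onto Aₙ: every summand of ∑_{i∈I} xᵢ + ∑_{i∉I} (1 - xᵢ) is at least tᵢ, and conversely
-- for x ∈ Aₙ the point t = (min(xᵢ, 1 - xᵢ))ᵢ works, because the subset
-- I = { i : xᵢ ≤ 1 - xᵢ } realises ∑ᵢ min(xᵢ, 1 - xᵢ) as one of the defining sums.
-- The group ℤ₂ ≀ Sₙ acts on x in the usual way and on t by permuting coordinates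
-- only; this preserves the inequalities since min(v, 1 - v) is reflection invariant.

open import Data.Nat as ℕ using (zero; suc)
import Data.Nat.Properties as ℕP
open import Data.Product using (_,_; proj₁; proj₂)
open import Data.Sum using (_⊎_; inj₁; inj₂; [_,_]′)
open import Data.Bool using (Bool; true; false; _xor_)
open import Data.Unit using (tt)
open import Data.Fin using (Fin; zero; suc; _↑ˡ_; _↑ʳ_; splitAt; join)
import Data.Fin.Properties as FinP
open import Data.Fin.Permutation using (Permutation′; _⟨$⟩ˡ_)
import Data.Fin.Permutation as Perm
open import Data.Fin.Subset using (Subset)
open import Data.Vec using (lookup; tabulate)
import Data.Vec.Properties as VecP
open import Data.Rational using (ℚ; 0ℚ; 1ℚ; ½; -_; _⊓_)
  renaming (_+_ to _⊕_; _*_ to _⊛_; _-_ to _⊖_; _≤_ to _≼_; _≤?_ to _≼?_)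
import Data.Rational.Properties as ℚP
open import Data.Rational.Solver using (module +-*-Solver)
open +-*-Solver using (solve; _:=_; _:+_; _:*_; :-_; _:-_; con)
import Algebra.Properties.CommutativeMonoid.Sum as MonoidSum
open import Function using (_∘_)
open import Function.Bundles using (_⇔_; mk⇔; Equivalence)
open import Relation.Binary.PropositionalEquality renaming (trans to ≡-trans)
open import Relation.Nullary using (Dec; yes; no; does)
open import Relation.Nullary.Decidable using (toWitness)

∑-cong : ∀ {k} {f g : Fin k → ℚ} → (∀ i → f i ≡ g i) → ∑ f ≡ ∑ g
∑-cong {zero}  f≡g = refl
∑-cong {suc k} f≡g = cong₂ _⊕_ (f≡g zero) (∑-cong (f≡g ∘ suc))

∑-mono : ∀ {k} {f g : Fin k → ℚ} → (∀ i → f i ≼ g i) → ∑ f ≼ ∑ g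
∑-mono {zero}  f≤g = ℚP.≤-refl
∑-mono {suc k} f≤g = ℚP.+-mono-≤ (f≤g zero) (∑-mono (f≤g ∘ suc))

∑-scale : ∀ {k} (c : ℚ) (f : Fin k → ℚ) → ∑ (λ i → c ⊛ f i) ≡ c ⊛ ∑ f
∑-scale {zero}  c f = sym (ℚP.*-zeroʳ c)
∑-scale {suc k} c f = ≡-trans (cong (c ⊛ f zero ⊕_) (∑-scale c (f ∘ suc)))
                           (sym (ℚP.*-distribˡ-+ c (f zero) (∑ (f ∘ suc))))

∑-split : ∀ m {n} (f : Fin (m ℕ.+ n) → ℚ) → ∑ f ≡ ∑ (λ i → f (i ↑ˡ n)) ⊕ ∑ (λ i → f (m ↑ʳ i))
∑-split zero    f = sym (ℚP.+-identityˡ (∑ f))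
∑-split (suc m) f = ≡-trans (cong (f zero ⊕_) (∑-split m (f ∘ suc))) (sym (ℚP.+-assoc (f zero) _ _))

module ℚ-Sum = MonoidSum ℚP.+-0-commutativeMonoid

∑≡sum : ∀ {k} (f : Fin k → ℚ) → ∑ f ≡ ℚ-Sum.sum f
∑≡sum {zero}  f = refl
∑≡sum {suc k} f = cong (f zero ⊕_) (∑≡sum (f ∘ suc))

∑-permute : ∀ {k} (π : Permutation′ k) (f : Fin k → ℚ) → ∑ (λ i → f (π ⟨$⟩ˡ i)) ≡ ∑ f
∑-permute π f = begin
  ∑ (λ i → f (π ⟨$⟩ˡ i))          ≡⟨ ∑≡sum (λ i → f (π ⟨$⟩ˡ i)) ⟩
  ℚ-Sum.sum (λ i → f (π ⟨$⟩ˡ i))  ≡⟨ sym (ℚ-Sum.sum-permute f (Perm.flip π)) ⟩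
  ℚ-Sum.sum f                     ≡⟨ sym (∑≡sum f) ⟩
  ∑ f                             ∎ where open ≡-Reasoning

⟨_,_⟩ : ∀ {d} → Pt d → Pt d → ℚ
⟨ a , y ⟩ = ∑ (λ j → a j ⊛ y j)

_·ᵛ_ : ∀ {d} → ℚ → Pt d → Pt d
(c ·ᵛ a) j = c ⊛ a j

𝟎 𝟙 : ∀ {d} → Pt d
𝟎 j = 0ℚ
𝟙 j = 1ℚ

δ : ∀ {d} → Fin d → Pt d
δ zero    zero    = 1ℚ
δ zero    (suc j) = 0ℚ
δ (suc k) zero    = 0ℚ
δ (suc k) (suc j) = δ k j

⟨⟩-scale : ∀ {d} c (a y : Pt d) → ⟨ c ·ᵛ a , y ⟩ ≡ c ⊛ ⟨ a , y ⟩
⟨⟩-scale c a y = ≡-trans (∑-cong (λ j → ℚP.*-assoc c (a j) (y j))) (∑-scale c (λ j → a j ⊛ y j))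

⟨𝟎⟩ : ∀ {d} (y : Pt d) → ⟨ 𝟎 , y ⟩ ≡ 0ℚ
⟨𝟎⟩ y = ≡-trans (∑-scale 0ℚ y) (ℚP.*-zeroˡ (∑ y))

⟨𝟙⟩ : ∀ {d} (y : Pt d) → ⟨ 𝟙 , y ⟩ ≡ ∑ y
⟨𝟙⟩ y = ∑-cong (λ j → ℚP.*-identityˡ (y j))

⟨δ⟩ : ∀ {d} (k : Fin d) (y : Pt d) → ⟨ δ k , y ⟩ ≡ y k
⟨δ⟩ zero y = begin
  1ℚ ⊛ y zero ⊕ ⟨ 𝟎 , y ∘ suc ⟩ ≡⟨ cong₂ _⊕_ (ℚP.*-identityˡ (y zero)) (⟨𝟎⟩ (y ∘ suc)) ⟩
  y zero ⊕ 0ℚ                   ≡⟨ ℚP.+-identityʳ (y zero) ⟩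
  y zero                        ∎ where open ≡-Reasoning
⟨δ⟩ (suc k) y = begin
  0ℚ ⊛ y zero ⊕ ⟨ δ k , y ∘ suc ⟩ ≡⟨ cong₂ _⊕_ (ℚP.*-zeroˡ (y zero)) (⟨δ⟩ k (y ∘ suc)) ⟩
  0ℚ ⊕ y (suc k)                  ≡⟨ ℚP.+-identityˡ (y (suc k)) ⟩
  y (suc k)                       ∎ where open ≡-Reasoning

⟨-1·⟩ : ∀ {d} (a y : Pt d) → ⟨ (- 1ℚ) ·ᵛ a , y ⟩ ≡ - ⟨ a , y ⟩
⟨-1·⟩ a y = ≡-trans (⟨⟩-scale (- 1ℚ) a y) (solve 1 (λ v → (:- con 1ℚ) :* v := :- v) refl ⟨ a , y ⟩)

neg-involutive : ∀ v → - (- v) ≡ v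
neg-involutive = solve 1 (λ v → :- (:- v) := v) refl

complement-involutive : ∀ v → 1ℚ ⊖ (1ℚ ⊖ v) ≡ v
complement-involutive = solve 1 (λ v → con 1ℚ :- (con 1ℚ :- v) := v) refl

move-≤ : ∀ a b c → (a ⊕ b ≼ c) ⇔ (a ≼ c ⊖ b)
move-≤ a b c = mk⇔
  (λ a+b≤c → subst (_≼ c ⊖ b) (solve 2 (λ a b → (a :+ b) :- b := a) refl a b)
                              (ℚP.+-monoˡ-≤ (- b) a+b≤c))
  (λ a≤c-b → subst (a ⊕ b ≼_) (solve 2 (λ c b → (c :- b) :+ b := c) refl c b)
                              (ℚP.+-monoˡ-≤ b a≤c-b))

neg-≤ : ∀ a b → (- a ≼ - b) ⇔ (b ≼ a)
neg-≤ a b = mk⇔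
  (λ -a≤-b → subst₂ _≼_ (neg-involutive b) (neg-involutive a) (ℚP.neg-antimono-≤ -a≤-b))
  ℚP.neg-antimono-≤

≼-by : ∀ {v w c} {P : Set} → v ≡ w → (w ≼ c) ⇔ P → (v ≼ c) ⇔ P
≼-by refl w≤c⇔P = w≤c⇔P

[_∣_] : ∀ {a} {A : Set a} {m n} → (Fin m → A) → (Fin n → A) → Fin (m ℕ.+ n) → A
[_∣_] {m = m} u v j = [ u , v ]′ (splitAt m j)

fstᵖ : ∀ {a} {A : Set a} {m n} → (Fin (m ℕ.+ n) → A) → Fin m → A
fstᵖ {n = n} y i = y (i ↑ˡ n)

sndᵖ : ∀ {a} {A : Set a} {m n} → (Fin (m ℕ.+ n) → A) → Fin n → A
sndᵖ {m = m} y i = y (m ↑ʳ i)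

fst-[∣] : ∀ {a} {A : Set a} {m n} (u : Fin m → A) (v : Fin n → A) i → fstᵖ [ u ∣ v ] i ≡ u i
fst-[∣] {m = m} {n} u v i = cong [ u , v ]′ (FinP.splitAt-↑ˡ m i n)

snd-[∣] : ∀ {a} {A : Set a} {m n} (u : Fin m → A) (v : Fin n → A) i → sndᵖ [ u ∣ v ] i ≡ v i
snd-[∣] {m = m} {n} u v i = cong [ u , v ]′ (FinP.splitAt-↑ʳ m n i)

↑-elim : ∀ {m n} {ℓ} (P : Fin (m ℕ.+ n) → Set ℓ) →
         (∀ i → P (i ↑ˡ n)) → (∀ i → P (m ↑ʳ i)) → ∀ j → P j
↑-elim {m} {n} P onLeft onRight j = subst P (FinP.join-splitAt m n j) (byCase (splitAt m j))
  where
  byCase : (v : Fin m ⊎ Fin n) → P (join m n v)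
  byCase (inj₁ i) = onLeft i
  byCase (inj₂ i) = onRight i

⟨[∣]⟩ : ∀ {m n} (a : Pt m) (b : Pt n) (y : Pt (m ℕ.+ n)) →
        ⟨ [ a ∣ b ] , y ⟩ ≡ ⟨ a , fstᵖ y ⟩ ⊕ ⟨ b , sndᵖ y ⟩
⟨[∣]⟩ {m} a b y = ≡-trans (∑-split m _)
  (cong₂ _⊕_ (∑-cong (λ i → cong (_⊛ fstᵖ y i) (fst-[∣] a b i)))
             (∑-cong (λ i → cong (_⊛ sndᵖ y i) (snd-[∣] a b i))))

⟨[∣𝟎]⟩ : ∀ {m n} (a : Pt m) (y : Pt (m ℕ.+ n)) → ⟨ [ a ∣ 𝟎 {n} ] , y ⟩ ≡ ⟨ a , fstᵖ {n = n} y ⟩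
⟨[∣𝟎]⟩ {m} {n} a y = begin
  ⟨ [ a ∣ 𝟎 ] , y ⟩           ≡⟨ ⟨[∣]⟩ a 𝟎 y ⟩
  ⟨ a , x ⟩ ⊕ ⟨ 𝟎 , t ⟩       ≡⟨ cong (⟨ a , x ⟩ ⊕_) (⟨𝟎⟩ t) ⟩
  ⟨ a , x ⟩ ⊕ 0ℚ              ≡⟨ ℚP.+-identityʳ ⟨ a , x ⟩ ⟩
  ⟨ a , x ⟩                   ∎
  where
  open ≡-Reasoning
  x : Pt m
  x = fstᵖ y
  t : Pt n
  t = sndᵖ {m = m} y

⟨[𝟎∣]⟩ : ∀ {m n} (b : Pt n) (y : Pt (m ℕ.+ n)) → ⟨ [ 𝟎 {m} ∣ b ] , y ⟩ ≡ ⟨ b , sndᵖ {m = m} y ⟩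
⟨[𝟎∣]⟩ {m} {n} b y = begin
  ⟨ [ 𝟎 ∣ b ] , y ⟩           ≡⟨ ⟨[∣]⟩ (𝟎 {m}) b y ⟩
  ⟨ 𝟎 , x ⟩ ⊕ ⟨ b , t ⟩       ≡⟨ cong (_⊕ ⟨ b , t ⟩) (⟨𝟎⟩ x) ⟩
  0ℚ ⊕ ⟨ b , t ⟩              ≡⟨ ℚP.+-identityˡ ⟨ b , t ⟩ ⟩
  ⟨ b , t ⟩                   ∎
  where
  open ≡-Reasoning
  x : Pt m
  x = fstᵖ {n = n} y
  t : Pt n
  t = sndᵖ {m = m} y

record System (d : ℕ) : Set where
  constructor system
  field
    rows : ℕ
    lhs  : Mat rows d
    rhs  : Pt rows
open System public

Satisfies : ∀ {d} → System d → Pt d → Set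
Satisfies S y = (r : Fin (rows S)) → (lhs S ·ᵥ y) r ≼ rhs S r

polytope : ∀ {d} → System d → HPoly d
polytope S = hpoly (rows S) 0 (lhs S) (rhs S) (λ ()) (λ ())

inQ⇔sat : ∀ {d} (S : System d) (y : Pt d) → InQ (polytope S) y ⇔ Satisfies S y
inQ⇔sat S y = mk⇔ proj₁ (λ sat → sat , λ ())

sat-rows : ∀ {d} (S : System d) (y : Pt d) {P : Fin (rows S) → Set} →
           (∀ r → (⟨ lhs S r , y ⟩ ≼ rhs S r) ⇔ P r) → Satisfies S y ⇔ (∀ r → P r)
sat-rows S y row⇔ = mk⇔ (λ sat r → Equivalence.to (row⇔ r) (sat r))
                        (λ p r → Equivalence.from (row⇔ r) (p r))

_++ˢ_ : ∀ {d} → System d → System d → System d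
S ++ˢ S′ = system (rows S ℕ.+ rows S′) [ lhs S ∣ lhs S′ ] [ rhs S ∣ rhs S′ ]

sat-++ : ∀ {d} (S S′ : System d) (y : Pt d) →
         Satisfies (S ++ˢ S′) y ⇔ (Satisfies S y × Satisfies S′ y)
sat-++ {d} S S′ y = mk⇔ to from
  where
  row≤ : Pt d → ℚ → Set
  row≤ a c = ⟨ a , y ⟩ ≼ c

  to : Satisfies (S ++ˢ S′) y → Satisfies S y × Satisfies S′ y
  to sat = (λ i → subst₂ row≤ (fst-[∣] (lhs S) (lhs S′) i) (fst-[∣] (rhs S) (rhs S′) i) (sat _))
         , (λ i → subst₂ row≤ (snd-[∣] (lhs S) (lhs S′) i) (snd-[∣] (rhs S) (rhs S′) i) (sat _))

  from : Satisfies S y × Satisfies S′ y → Satisfies (S ++ˢ S′) y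
  from (sat , sat′) r with splitAt (rows S) r
  ... | inj₁ i = sat i
  ... | inj₂ i = sat′ i

aact-cong : ∀ {n d} (ρ : AffAction n d) g {y z : Pt d} → (∀ j → y j ≡ z j) →
            ∀ j → aact ρ g y j ≡ aact ρ g z j
aact-cong ρ g y≡z j = cong (_⊕ trans ρ g j) (∑-cong (λ l → cong (lin ρ g j l ⊛_) (y≡z l)))

hact-cong : ∀ {n} (g : Hyp n) {x x′ : Pt n} → (∀ i → x i ≡ x′ i) → ∀ i → hact g x i ≡ hact g x′ i
hact-cong g x≡x′ i = cong (flipIf (flips g i)) (x≡x′ (perm g ⟨$⟩ˡ i))

flipIf-xor : ∀ a b v → flipIf (a xor b) v ≡ flipIf a (flipIf b v)
flipIf-xor true  true  v = sym (complement-involutive v)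
flipIf-xor true  false v = refl
flipIf-xor false true  v = refl
flipIf-xor false false v = refl

ε : ∀ {n} → Hyp n
ε = hyp Perm.id (λ _ → false)

hact-⊗ : ∀ {n} (g h : Hyp n) x i → hact (g ⊗ h) x i ≡ hact g (hact h x) i
hact-⊗ g h x i = flipIf-xor (flips g i) (flips h (perm g ⟨$⟩ˡ i)) _

sgn off : Bool → ℚ
sgn true  = - 1ℚ
sgn false = 1ℚ
off true  = 1ℚ
off false = 0ℚ

flipIf-affine : ∀ b v → sgn b ⊛ v ⊕ off b ≡ flipIf b v
flipIf-affine true  v = solve 1 (λ v → (:- con 1ℚ) :* v :+ con 1ℚ := con 1ℚ :- v) refl v
flipIf-affine false v = solve 1 (λ v → con 1ℚ :* v :+ con 0ℚ := v) refl v

hypAction : ∀ {n} → AffAction n n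
hypAction = affAction (λ g i → sgn (flips g i) ·ᵛ δ (perm g ⟨$⟩ˡ i)) (λ g i → off (flips g i))

aact-hyp : ∀ {n} (g : Hyp n) (x : Pt n) i → aact hypAction g x i ≡ hact g x i
aact-hyp {n} g x i = begin
  ⟨ sgn r ·ᵛ δ j , x ⟩ ⊕ off r ≡⟨ cong (_⊕ off r) (⟨⟩-scale (sgn r) (δ j) x) ⟩
  sgn r ⊛ ⟨ δ j , x ⟩ ⊕ off r  ≡⟨ cong (λ v → sgn r ⊛ v ⊕ off r) (⟨δ⟩ j x) ⟩
  sgn r ⊛ x j ⊕ off r          ≡⟨ flipIf-affine r (x j) ⟩
  flipIf r (x j)               ∎
  where
  open ≡-Reasoning
  r : Bool
  r = flips g i
  j : Fin n
  j = perm g ⟨$⟩ˡ i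

hypAction-isAction : ∀ {n} → IsAction (hypAction {n})
hypAction-isAction = aact-hyp ε , comp
  where
  comp : ∀ g h x i → aact hypAction (g ⊗ h) x i ≡ aact hypAction g (aact hypAction h x) i
  comp g h x i = begin
    aact hypAction (g ⊗ h) x i          ≡⟨ aact-hyp (g ⊗ h) x i ⟩
    hact (g ⊗ h) x i                    ≡⟨ hact-⊗ g h x i ⟩
    hact g (hact h x) i                 ≡⟨ hact-cong g (λ j → sym (aact-hyp h x j)) i ⟩
    hact g (aact hypAction h x) i       ≡⟨ sym (aact-hyp g _ i) ⟩
    aact hypAction g (aact hypAction h x) i ∎ where open ≡-Reasoning

-- Forgetting the reflections is a homomorphism ℤ₂ ≀ Sₙ → Sₙ (definitionally), so
-- restricting the natural action along it gives the permutation action on ℚⁿ.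
unflipped : ∀ {n} → Hyp n → Hyp n
unflipped g = hyp (perm g) (λ _ → false)

permAction : ∀ {n} → AffAction n n
permAction = affAction (lin hypAction ∘ unflipped) (trans hypAction ∘ unflipped)

permAction-isAction : ∀ {n} → IsAction (permAction {n})
permAction-isAction = proj₁ hypAction-isAction ,
  λ g h → proj₂ hypAction-isAction (unflipped g) (unflipped h)

blockAction : ∀ {n a b} → AffAction n a → AffAction n b → AffAction n (a ℕ.+ b)
blockAction ρ σ = affAction
  (λ g → [ (λ i → [ lin ρ g i ∣ 𝟎 ]) ∣ (λ i → [ 𝟎 ∣ lin σ g i ]) ])
  (λ g → [ trans ρ g ∣ trans σ g ])

module _ {n a b} (ρ : AffAction n a) (σ : AffAction n b) where

  private
    ρσ : AffAction n (a ℕ.+ b)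
    ρσ = blockAction ρ σ

    linˡ : Hyp n → Fin a → Pt (a ℕ.+ b)
    linˡ g i = [ lin ρ g i ∣ 𝟎 ]

    linʳ : Hyp n → Fin b → Pt (a ℕ.+ b)
    linʳ g i = [ 𝟎 ∣ lin σ g i ]

  fst-block : ∀ g y i → fstᵖ (aact ρσ g y) i ≡ aact ρ g (fstᵖ y) i
  fst-block g y i = begin
    aact ρσ g y (i ↑ˡ b)
      ≡⟨ cong₂ (λ row c → ⟨ row , y ⟩ ⊕ c) (fst-[∣] (linˡ g) (linʳ g) i)
                                            (fst-[∣] (trans ρ g) (trans σ g) i) ⟩
    ⟨ [ lin ρ g i ∣ 𝟎 ] , y ⟩ ⊕ trans ρ g i  ≡⟨ cong (_⊕ trans ρ g i) (⟨[∣𝟎]⟩ (lin ρ g i) y) ⟩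
    aact ρ g (fstᵖ y) i                      ∎ where open ≡-Reasoning

  snd-block : ∀ g y i → sndᵖ (aact ρσ g y) i ≡ aact σ g (sndᵖ {m = a} y) i
  snd-block g y i = begin
    aact ρσ g y (a ↑ʳ i)
      ≡⟨ cong₂ (λ row c → ⟨ row , y ⟩ ⊕ c) (snd-[∣] (linˡ g) (linʳ g) i)
                                            (snd-[∣] (trans ρ g) (trans σ g) i) ⟩
    ⟨ [ 𝟎 ∣ lin σ g i ] , y ⟩ ⊕ trans σ g i  ≡⟨ cong (_⊕ trans σ g i) (⟨[𝟎∣]⟩ (lin σ g i) y) ⟩
    aact σ g (sndᵖ {m = a} y) i              ∎ where open ≡-Reasoning

  blockAction-isAction : IsAction ρ → IsAction σ → IsAction ρσ
  blockAction-isAction (idρ , compρ) (idσ , compσ) = act-id , act-comp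
    where
    act-id : ∀ y j → aact ρσ ε y j ≡ y j
    act-id y = ↑-elim (λ j → aact ρσ ε y j ≡ y j)
      (λ i → ≡-trans (fst-block ε y i) (idρ (fstᵖ y) i))
      (λ i → ≡-trans (snd-block ε y i) (idσ (sndᵖ {m = a} y) i))

    act-comp : ∀ g h y j → aact ρσ (g ⊗ h) y j ≡ aact ρσ g (aact ρσ h y) j
    act-comp g h y = ↑-elim (λ j → aact ρσ (g ⊗ h) y j ≡ aact ρσ g (aact ρσ h y) j)
      (λ i → begin
         aact ρσ (g ⊗ h) y (i ↑ˡ b)           ≡⟨ fst-block (g ⊗ h) y i ⟩
         aact ρ (g ⊗ h) (fstᵖ y) i            ≡⟨ compρ g h (fstᵖ y) i ⟩
         aact ρ g (aact ρ h (fstᵖ y)) i       ≡⟨ aact-cong ρ g (λ l → sym (fst-block h y l)) i ⟩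
         aact ρ g (fstᵖ (aact ρσ h y)) i      ≡⟨ sym (fst-block g (aact ρσ h y) i) ⟩
         aact ρσ g (aact ρσ h y) (i ↑ˡ b)     ∎)
      (λ i → begin
         aact ρσ (g ⊗ h) y (a ↑ʳ i)           ≡⟨ snd-block (g ⊗ h) y i ⟩
         aact σ (g ⊗ h) (sndᵖ {m = a} y) i    ≡⟨ compσ g h (sndᵖ {m = a} y) i ⟩
         aact σ g (aact σ h (sndᵖ {m = a} y)) i ≡⟨ aact-cong σ g (λ l → sym (snd-block h y l)) i ⟩
         aact σ g (sndᵖ {m = a} (aact ρσ h y)) i ≡⟨ sym (snd-block g (aact ρσ h y) i) ⟩
         aact ρσ g (aact ρσ h y) (a ↑ʳ i)     ∎)
      where open ≡-Reasoning

Below : ℚ → ℚ → Set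
Below t v = (t ≼ v) × (t ≼ 1ℚ ⊖ v)

Ext : ∀ {n} → Pt n → Pt n → Set
Ext x t = (∀ i → Below (t i) (x i)) × (∀ i → 0ℚ ≼ t i) × (½ ≼ ∑ t)

-- min(v, 1 - v) is invariant under the reflection v ↦ 1 - v.
below-flip : ∀ r {t v} → Below t v → Below t (flipIf r v)
below-flip true  {t} {v} (t≤v , t≤1-v) = t≤1-v , subst (t ≼_) (sym (complement-involutive v)) t≤v
below-flip false below = below

-- Every summand of the sum defining Aₙ is one of v, 1 - v.
below-termI : ∀ {n} (I : Subset n) (x : Pt n) i {t} → Below t (x i) → t ≼ termI I x i
below-termI I x i below with lookup I i
... | true  = proj₁ below
... | false = proj₂ below

below-bounds : ∀ {t v} → 0ℚ ≼ t → Below t v → (0ℚ ≼ v) × (v ≼ 1ℚ) × (t ≼ 1ℚ)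
below-bounds {t} {v} 0≤t (t≤v , t≤1-v) = ℚP.≤-trans 0≤t t≤v , v≤1 , ℚP.≤-trans t≤v v≤1
  where
  v≤1 : v ≼ 1ℚ
  v≤1 = ℚP.≤-trans (subst (_≼ t ⊕ v) (ℚP.+-identityˡ v) (ℚP.+-monoˡ-≤ v 0≤t))
                   (Equivalence.from (move-≤ t v 1ℚ) t≤1-v)

fold : ℚ → ℚ
fold v = v ⊓ (1ℚ ⊖ v)

fold-below : ∀ v → Below (fold v) v
fold-below v = ℚP.p⊓q≤p v (1ℚ ⊖ v) , ℚP.p⊓q≤q v (1ℚ ⊖ v)

fold-nonneg : ∀ {v} → 0ℚ ≼ v → v ≼ 1ℚ → 0ℚ ≼ fold v
fold-nonneg {v} 0≤v v≤1 =
  ℚP.⊓-glb 0≤v (Equivalence.to (move-≤ 0ℚ v 1ℚ) (subst (_≼ 1ℚ) (sym (ℚP.+-identityˡ v)) v≤1))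

pick : Bool → ℚ → ℚ
pick true  v = v
pick false v = 1ℚ ⊖ v

termI-pick : ∀ {n} (I : Subset n) (x : Pt n) i {r} → lookup I i ≡ r → termI I x i ≡ pick r (x i)
termI-pick I x i lookup≡r with lookup I i
termI-pick I x i refl | true  = refl
termI-pick I x i refl | false = refl

pick-fold : ∀ v (v≤1-v? : Dec (v ≼ 1ℚ ⊖ v)) → pick (does v≤1-v?) v ≡ fold v
pick-fold v (yes v≤1-v) = sym (ℚP.p≤q⇒p⊓q≡p v≤1-v)
pick-fold v (no  v≰1-v) = sym (ℚP.p≥q⇒p⊓q≡q (ℚP.<⇒≤ (ℚP.≰⇒> v≰1-v)))

foldSubset : ∀ {n} → Pt n → Subset n
foldSubset x = tabulate (λ i → does (x i ≼? 1ℚ ⊖ x i))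

termI-foldSubset : ∀ {n} (x : Pt n) i → termI (foldSubset x) x i ≡ fold (x i)
termI-foldSubset x i =
  ≡-trans (termI-pick (foldSubset x) x i (VecP.lookup∘tabulate _ i)) (pick-fold (x i) (x i ≼? 1ℚ ⊖ x i))

ext-bounds : ∀ {n} {x t : Pt n} → Ext x t → ∀ i → ((0ℚ ≼ x i) × (x i ≼ 1ℚ)) × ((0ℚ ≼ t i) × (t i ≼ 1ℚ))
ext-bounds (below , nonneg , _) i =
  let (0≤x , x≤1 , t≤1) = below-bounds (nonneg i) (below i) in (0≤x , x≤1) , (nonneg i , t≤1)

-- Projection: Ext x t implies x ∈ Aₙ, since every defining sum dominates ∑ t.
ext-projects : ∀ {n} {x t : Pt n} → Ext x t → InA n x
ext-projects {x = x} ext@(below , _ , half≤∑t) =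
    (λ i → proj₁ (ext-bounds ext i))
  , (λ I → ℚP.≤-trans half≤∑t (∑-mono (λ i → below-termI I x i (below i))))

-- Lifting: every x ∈ Aₙ lifts with t = fold ∘ x, whose sum is the sum for foldSubset x.
ext-lifts : ∀ {n} {x : Pt n} → InA n x → Ext x (fold ∘ x)
ext-lifts {x = x} (cube , half≤sums) =
    (λ i → fold-below (x i))
  , (λ i → fold-nonneg (proj₁ (cube i)) (proj₂ (cube i)))
  , subst (½ ≼_) (∑-cong (termI-foldSubset x)) (half≤sums (foldSubset x))

ext-invariant : ∀ {n} (g : Hyp n) {x t : Pt n} → Ext x t → Ext (hact g x) (hact (unflipped g) t)
ext-invariant g {t = t} (below , nonneg , half≤∑t) =
    (λ i → below-flip (flips g i) (below (perm g ⟨$⟩ˡ i)))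
  , (λ i → nonneg (perm g ⟨$⟩ˡ i))
  , subst (½ ≼_) (sym (∑-permute (perm g) t)) half≤∑t

-- Ext respects pointwise equality (needed because actions are computed pointwise).
ext-resp : ∀ {n} {x x′ t t′ : Pt n} → (∀ i → x i ≡ x′ i) → (∀ i → t i ≡ t′ i) → Ext x t → Ext x′ t′
ext-resp x≡x′ t≡t′ (below , nonneg , half≤∑t) =
    (λ i → subst₂ Below (t≡t′ i) (x≡x′ i) (below i))
  , (λ i → subst (0ℚ ≼_) (t≡t′ i) (nonneg i))
  , subst (½ ≼_) (∑-cong t≡t′) half≤∑t

module Extension (n : ℕ) where

  d : ℕ
  d = n ℕ.+ n

  X T : Pt d → Pt n
  X = fstᵖ {m = n} {n = n}
  T = sndᵖ {m = n} {n = n}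

  infixl 5 _⊞_
  _⊞_ : Pt n → Pt n → Pt d
  a ⊞ b = [ a ∣ b ]

  ⟨⊞⟩ : ∀ a b y → ⟨ a ⊞ b , y ⟩ ≡ ⟨ a , X y ⟩ ⊕ ⟨ b , T y ⟩
  ⟨⊞⟩ = ⟨[∣]⟩

  t≤x t+x≤1 t≥0 ∑t≥½ : System d
  t≤x   = system n (λ i → (- 1ℚ) ·ᵛ δ i ⊞ δ i) (λ _ → 0ℚ)
  t+x≤1 = system n (λ i → δ i ⊞ δ i)            (λ _ → 1ℚ)
  t≥0   = system n (λ i → 𝟎 ⊞ (- 1ℚ) ·ᵛ δ i)    (λ _ → 0ℚ)
  ∑t≥½  = system 1 (λ _ → 𝟎 ⊞ (- 1ℚ) ·ᵛ 𝟙)     (λ _ → - ½)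

  S : System d
  S = t≤x ++ˢ (t+x≤1 ++ˢ (t≥0 ++ˢ ∑t≥½))

  module _ (y : Pt d) where

    sat-t≤x : Satisfies t≤x y ⇔ (∀ i → T y i ≼ X y i)
    sat-t≤x = sat-rows t≤x y λ i → ≼-by
      (begin
         ⟨ (- 1ℚ) ·ᵛ δ i ⊞ δ i , y ⟩           ≡⟨ ⟨⊞⟩ ((- 1ℚ) ·ᵛ δ i) (δ i) y ⟩
         ⟨ (- 1ℚ) ·ᵛ δ i , X y ⟩ ⊕ ⟨ δ i , T y ⟩ ≡⟨ cong₂ _⊕_ (⟨-1·⟩ (δ i) (X y)) (⟨δ⟩ i (T y)) ⟩
         - ⟨ δ i , X y ⟩ ⊕ T y i                ≡⟨ cong (λ v → - v ⊕ T y i) (⟨δ⟩ i (X y)) ⟩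
         - X y i ⊕ T y i                        ≡⟨ ℚP.+-comm (- X y i) (T y i) ⟩
         T y i ⊕ - X y i                        ∎)
      (subst (λ w → (T y i ⊕ - X y i ≼ 0ℚ) ⇔ (T y i ≼ w))
             (solve 1 (λ v → con 0ℚ :- (:- v) := v) refl (X y i))
             (move-≤ (T y i) (- X y i) 0ℚ))
      where open ≡-Reasoning

    sat-t+x≤1 : Satisfies t+x≤1 y ⇔ (∀ i → T y i ≼ 1ℚ ⊖ X y i)
    sat-t+x≤1 = sat-rows t+x≤1 y λ i → ≼-by
      (begin
         ⟨ δ i ⊞ δ i , y ⟩               ≡⟨ ⟨⊞⟩ (δ i) (δ i) y ⟩
         ⟨ δ i , X y ⟩ ⊕ ⟨ δ i , T y ⟩   ≡⟨ cong₂ _⊕_ (⟨δ⟩ i (X y)) (⟨δ⟩ i (T y)) ⟩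
         X y i ⊕ T y i                   ≡⟨ ℚP.+-comm (X y i) (T y i) ⟩
         T y i ⊕ X y i                   ∎)
      (move-≤ (T y i) (X y i) 1ℚ)
      where open ≡-Reasoning

    sat-t≥0 : Satisfies t≥0 y ⇔ (∀ i → 0ℚ ≼ T y i)
    sat-t≥0 = sat-rows t≥0 y λ i → ≼-by
      (begin
         ⟨ 𝟎 ⊞ (- 1ℚ) ·ᵛ δ i , y ⟩   ≡⟨ ⟨[𝟎∣]⟩ {m = n} ((- 1ℚ) ·ᵛ δ i) y ⟩
         ⟨ (- 1ℚ) ·ᵛ δ i , T y ⟩     ≡⟨ ⟨-1·⟩ (δ i) (T y) ⟩
         - ⟨ δ i , T y ⟩             ≡⟨ cong -_ (⟨δ⟩ i (T y)) ⟩
         - T y i                     ∎)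
      (neg-≤ (T y i) 0ℚ)
      where open ≡-Reasoning

    sat-∑t≥½ : Satisfies ∑t≥½ y ⇔ (Fin 1 → ½ ≼ ∑ (T y))
    sat-∑t≥½ = sat-rows ∑t≥½ y λ _ → ≼-by
      (begin
         ⟨ 𝟎 ⊞ (- 1ℚ) ·ᵛ 𝟙 , y ⟩     ≡⟨ ⟨[𝟎∣]⟩ {m = n} ((- 1ℚ) ·ᵛ 𝟙) y ⟩
         ⟨ (- 1ℚ) ·ᵛ 𝟙 , T y ⟩       ≡⟨ ⟨-1·⟩ 𝟙 (T y) ⟩
         - ⟨ 𝟙 , T y ⟩               ≡⟨ cong -_ (⟨𝟙⟩ (T y)) ⟩
         - ∑ (T y)                   ∎)
      (neg-≤ (∑ (T y)) ½)
      where open ≡-Reasoning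

    sat⇔ext : Satisfies S y ⇔ Ext (X y) (T y)
    sat⇔ext = mk⇔ sat⇒ext ext⇒sat
      where
      open Equivalence using (to; from)

      sat⇒ext : Satisfies S y → Ext (X y) (T y)
      sat⇒ext sat =
        let (s₁ , s₂₃₄) = to (sat-++ t≤x _ y) sat
            (s₂ , s₃₄)  = to (sat-++ t+x≤1 _ y) s₂₃₄
            (s₃ , s₄)   = to (sat-++ t≥0 ∑t≥½ y) s₃₄
        in  (λ i → to sat-t≤x s₁ i , to sat-t+x≤1 s₂ i) , to sat-t≥0 s₃ , to sat-∑t≥½ s₄ zero

      ext⇒sat : Ext (X y) (T y) → Satisfies S y
      ext⇒sat (below , nonneg , half≤∑t) =
        from (sat-++ t≤x _ y) (from sat-t≤x (proj₁ ∘ below) ,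
        from (sat-++ t+x≤1 _ y) (from sat-t+x≤1 (proj₂ ∘ below) ,
        from (sat-++ t≥0 ∑t≥½ y) (from sat-t≥0 nonneg , from sat-∑t≥½ (λ _ → half≤∑t))))

  Q : HPoly d
  Q = polytope S

  inQ⇔ext : ∀ y → InQ Q y ⇔ Ext (X y) (T y)
  inQ⇔ext y = mk⇔ (Equivalence.to (sat⇔ext y) ∘ Equivalence.to (inQ⇔sat S y))
                  (Equivalence.from (inQ⇔sat S y) ∘ Equivalence.from (sat⇔ext y))

  ρ : AffAction n d
  ρ = blockAction hypAction permAction

  X-aact : ∀ g y i → X (aact ρ g y) i ≡ hact g (X y) i
  X-aact g y i = ≡-trans (fst-block hypAction permAction g y i) (aact-hyp g (X y) i)

  T-aact : ∀ g y i → T (aact ρ g y) i ≡ hact (unflipped g) (T y) i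
  T-aact g y i = ≡-trans (snd-block hypAction permAction g y i) (aact-hyp (unflipped g) (T y) i)

  p : Mat n d
  p i = δ i ⊞ 𝟎

  p-X : ∀ y i → (p ·ᵥ y) i ≡ X y i
  p-X y i = ≡-trans (⟨[∣𝟎]⟩ {n = n} (δ i) y) (⟨δ⟩ i (X y))

  bounded : Bounded Q
  bounded = 1ℚ , λ y y∈Q →
    let bounds = ext-bounds (Equivalence.to (inQ⇔ext y) y∈Q)
    in  ↑-elim _ (λ i → widen (proj₁ (bounds i))) (λ i → widen (proj₂ (bounds i)))
    where
    -1≤0 : 0ℚ ⊖ 1ℚ ≼ 0ℚ
    -1≤0 = toWitness {a? = 0ℚ ⊖ 1ℚ ≼? 0ℚ} tt

    widen : ∀ {v} → (0ℚ ≼ v) × (v ≼ 1ℚ) → (0ℚ ⊖ 1ℚ ≼ v) × (v ≼ 1ℚ)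
    widen (0≤v , v≤1) = ℚP.≤-trans -1≤0 0≤v , v≤1

  symExt : SymExt n (rows S)
  symExt = record
    { d = d ; Q = Q ; size≤ = ℕP.≤-refl ; bdd = bounded
    ; ρ = ρ ; isAct = blockAction-isAction hypAction permAction hypAction-isAction permAction-isAction
    ; inv = invariant ; p = p ; proj⊆ = projects ; proj⊇ = lifts ; equiv = equivariant }
    where
    open Equivalence using (to; from)

    invariant : ∀ g y → InQ Q y → InQ Q (aact ρ g y)
    invariant g y y∈Q = from (inQ⇔ext (aact ρ g y))
      (ext-resp (sym ∘ X-aact g y) (sym ∘ T-aact g y) (ext-invariant g (to (inQ⇔ext y) y∈Q)))

    projects : ∀ y → InQ Q y → InA n (p ·ᵥ y)
    projects y y∈Q = ext-projects (ext-resp (sym ∘ p-X y) (λ _ → refl) (to (inQ⇔ext y) y∈Q))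

    lifts : ∀ x → InA n x → Σ (Pt d) λ y → InQ Q y × (∀ i → (p ·ᵥ y) i ≡ x i)
    lifts x x∈A = y , from (inQ⇔ext y) (ext-resp (sym ∘ X-y) (sym ∘ T-y) (ext-lifts x∈A))
                    , λ i → ≡-trans (p-X y i) (X-y i)
      where
      y : Pt d
      y = x ⊞ (fold ∘ x)
      X-y : ∀ i → X y i ≡ x i
      X-y = fst-[∣] x (fold ∘ x)
      T-y : ∀ i → T y i ≡ fold (x i)
      T-y = snd-[∣] x (fold ∘ x)

    equivariant : ∀ g y → InQ Q y → ∀ i → (p ·ᵥ aact ρ g y) i ≡ hact g (p ·ᵥ y) i
    equivariant g y _ i = begin
      (p ·ᵥ aact ρ g y) i ≡⟨ p-X (aact ρ g y) i ⟩
      X (aact ρ g y) i    ≡⟨ X-aact g y i ⟩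
      hact g (X y) i      ≡⟨ hact-cong g (sym ∘ p-X y) i ⟩
      hact g (p ·ᵥ y) i   ∎ where open ≡-Reasoning

3n+1≤4n : ∀ n → 1 ≤ n → n ℕ.+ (n ℕ.+ (n ℕ.+ 1)) ≤ 4 * n
3n+1≤4n n 1≤n = ℕP.+-monoʳ-≤ n (ℕP.+-monoʳ-≤ n (ℕP.+-monoʳ-≤ n (subst (1 ≤_) (sym (ℕP.+-identityʳ n)) 1≤n)))

theorem4p1 : Σ ℕ λ C → (n : ℕ) → 1 ≤ n → Σ ℕ λ s → s ≤ C * n × SymExt n s
theorem4p1 = 4 , λ n 1≤n → n ℕ.+ (n ℕ.+ (n ℕ.+ 1)) , 3n+1≤4n n 1≤n , Extension.symExt n
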